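{- Suppose that $\langle\pi,\psi,b\rangle$ is a normal triple, $c\in\mathbb P$, $n_0<\omega$, $c\le_{n_0}b$, and $a$ is an infinite subset of $\pi''\mathrm{set}(c)[n_0]$. For $n<\omega$ let $F_n=\{m<\omega:\pi''c(m)=\{a(n)\}\}$. Then for every $n<\omega$: $F_n\setminus n_0\neq\emptyset$, $|F_n|<\omega$, and $\max(F_n)<\min(F_{n+1}\setminus n_0)\le\max(F_{n+1})$.
   Context: $\mathbb P$ is the set of functions $c:\omega\to[\omega]^{<\omega}\setminus\{\emptyset\}$ with $|c(n)|<|c(n+1)|$ and $\max c(n)<\min c(n+1)$ for all $n$. For $c,d\in\mathbb P$ and $l<\omega$, $c\le_l d$ means that for every $m\ge l$ there is $n\ge m$ with $c(m)\subseteq d(n)$. $\mathrm{set}(c)=\bigcup_n c(n)$ and $\mathrm{set}(c)[\eta]=\bigcup_{\xi\ge\eta}c(\xi)$. For infinite $A\subseteq\omega$, $A(m)$ is the $m$-th element of $A$ in increasing order. $\pi''Z$ is the image of $Z$. A triple $\langle\pi,\psi,b\rangle$ is a normal triple if $\pi,\psi\in\omega^\omega$, $\psi(l)\le\psi(l')$ whenever $l\le l'$, $\mathrm{ran}(\psi)$ is infinite, $b\in\mathbb P$, $\pi''b(l)=\{\psi(l)\}$ for every $l$, and $\pi(n)=0$ for $n\notin\mathrm{set}(b)$. -}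

module Defs where

open import Data.Nat using (ℕ; zero; suc; _≤_; _<_)
open import Data.List using (List; length)
open import Data.List.Membership.Propositional using (_∈_)
open import Data.List.Relation.Unary.Linked using (Linked)
open import Data.Product using (_×_; ∃-syntax)
open import Relation.Binary.PropositionalEquality using (_≡_)
open import Relation.Nullary using (¬_)
open import Relation.Unary using (Pred)
open import Level using (0ℓ)
open import Function.Bundles using (_⇔_)

-- A finite subset of ω is represented canonically by the strictly increasing
-- list of its elements (so its cardinality is the length of the list).

record ℙ : Set where
  field
    seq      : ℕ → List ℕ
    sorted   : ∀ n → Linked _<_ (seq n)
    nonempty : ∀ n → 0 < length (seq n)
    card-inc : ∀ n → length (seq n) < length (seq (suc n))
    sep      : ∀ n x y → x ∈ seq n → y ∈ seq (suc n) → x < y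
open ℙ public

_≤[_]_ : ℙ → ℕ → ℙ → Set
c ≤[ l ] d = ∀ m → l ≤ m → ∃[ n ] (m ≤ n × (∀ x → x ∈ seq c m → x ∈ seq d n))

setFrom : ℙ → ℕ → Pred ℕ 0ℓ
setFrom c η x = ∃[ ξ ] (η ≤ ξ × x ∈ seq c ξ)

set : ℙ → Pred ℕ 0ℓ
set c = setFrom c 0

image : (ℕ → ℕ) → Pred ℕ 0ℓ → Pred ℕ 0ℓ
image π Z y = ∃[ x ] (Z x × π x ≡ y)

ImageIsSingleton : (ℕ → ℕ) → Pred ℕ 0ℓ → ℕ → Set
ImageIsSingleton π Z z = ∀ y → (image π Z y ⇔ (y ≡ z))

cset : ℙ → ℕ → Pred ℕ 0ℓ
cset c m x = x ∈ seq c m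

Infinite : Pred ℕ 0ℓ → Set
Infinite A = ∀ k → ∃[ x ] (k ≤ x × A x)

Finite : Pred ℕ 0ℓ → Set
Finite A = ∃[ xs ] (∀ m → (A m ⇔ (m ∈ xs)))

range : (ℕ → ℕ) → Pred ℕ 0ℓ
range f y = ∃[ l ] (f l ≡ y)

-- e is the increasing enumeration of A, i.e. e(m) = A(m), the m-th element of A
Enumerates : Pred ℕ 0ℓ → (ℕ → ℕ) → Set
Enumerates A e = (∀ m → e m < e (suc m)) × (∀ x → (A x ⇔ range e x))

record NormalTriple (π ψ : ℕ → ℕ) (b : ℙ) : Set where
  field
    ψ-mono   : ∀ l l′ → l ≤ l′ → ψ l ≤ ψ l′
    ψ-ranInf : Infinite (range ψ)
    π-img    : ∀ l → ImageIsSingleton π (cset b l) (ψ l)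
    π-zero   : ∀ n → ¬ set b n → π n ≡ 0

IsMax : Pred ℕ 0ℓ → ℕ → Set
IsMax A x = A x × (∀ y → A y → y ≤ x)

IsMin : Pred ℕ 0ℓ → ℕ → Set
IsMin A x = A x × (∀ y → A y → x ≤ y)

F : (ℕ → ℕ) → ℙ → (ℕ → ℕ) → ℕ → Pred ℕ 0ℓ
F π c a n m = ImageIsSingleton π (cset c m) (a n)

_∖below_ : Pred ℕ 0ℓ → ℕ → Pred ℕ 0ℓ
(A ∖below n₀) m = A m × n₀ ≤ m

-- A normal triple makes π constant, with value ψ(l), on each block b(l). Since c ≤_{n₀} b
-- puts every block c(m) with m ≥ n₀ inside some b(j) with j ≥ m, π is constant on such c(m),
-- weakly increasing in m, and eventually above any bound because ran ψ is infinite. So each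
-- F_n meets [n₀, ω) (as a(n) ∈ π''set(c)[n₀]) and is bounded, hence finite with a maximum;
-- and an m ≥ n₀ in F_{n+1} cannot lie at or below an element of F_n, since a(n) < a(n+1).
module Submission where

open import Defs
open import Data.Nat using (ℕ; suc; _+_; _≤_; _<_; _≟_; _<?_; _≤?_)
open import Data.Nat.Properties
open import Data.Product using (_×_; ∃; ∃-syntax; _,_; proj₁; proj₂)
open import Data.Sum using (inj₁; inj₂)
open import Data.List using (List; _∷_; filter; upTo)
open import Data.List.Relation.Unary.Any using (here)
open import Data.List.Relation.Unary.All as All using (All)
open import Data.List.Membership.Propositional using (_∈_)
open import Data.List.Membership.Propositional.Properties using (∈-filter⁺; ∈-filter⁻; ∈-upTo⁺)
open import Data.List.Extrema.Nat using (min; max; argmin-all; argmax-all; min≤xs; min≤⊤; xs≤max)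
open import Relation.Unary using (Pred; Decidable; _⊆_)
open import Relation.Unary.Properties using (_∩?_)
open import Relation.Nullary using (Dec; yes; no; ¬_)
open import Relation.Nullary.Decidable using (map′)
open import Relation.Binary.PropositionalEquality using (_≡_; refl; sym; trans; subst₂)
open import Function.Bundles using (mk⇔; Equivalence)
open import Level using (0ℓ)

open Equivalence

module _ {P : Pred ℕ 0ℓ} (P? : Decidable P) where

  private
    below : ℕ → List ℕ
    below k = filter P? (upTo k)

    below-sound : ∀ {k m} → m ∈ below k → P m
    below-sound {k} m∈ = proj₂ (∈-filter⁻ P? {xs = upTo k} m∈)

    below-complete : ∀ {k m} → m < k → P m → m ∈ below k
    below-complete m<k pm = ∈-filter⁺ P? (∈-upTo⁺ m<k) pm

    All-below : ∀ k → All P (below k)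
    All-below k = All.tabulate (below-sound {k})

  bounded⇒finite : ∀ {k} → (∀ {m} → P m → m < k) → Finite P
  bounded⇒finite {k} bound = below k , λ m →
    mk⇔ (λ pm → below-complete (bound pm) pm) (below-sound {k})

  bounded⇒∃max : ∀ {k x} → (∀ {m} → P m → m < k) → P x → ∃ (IsMax P)
  bounded⇒∃max {k} {x} bound px =
    max x (below k) , argmax-all (λ y → y) px (All-below k) ,
    λ y py → All.lookup (xs≤max x (below k)) (below-complete (bound py) py)

  ∃min : ∀ {x} → P x → ∃ (IsMin P)
  ∃min {x} px = min x (below x) , argmin-all (λ y → y) px (All-below x) , least
    where
    least : ∀ y → P y → min x (below x) ≤ y
    least y py with y <? x
    ... | yes y<x = All.lookup (min≤xs x (below x)) (below-complete y<x py)
    ... | no  y≮x = ≤-trans (min≤⊤ x (below x)) (≮⇒≥ y≮x)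

∃-∈-seq : (d : ℙ) (m : ℕ) → ∃ (_∈ seq d m)
∃-∈-seq d m with seq d m | nonempty d m
... | x ∷ _ | _ = x , here refl

sep-< : (d : ℙ) {i j x y : ℕ} → i < j → x ∈ seq d i → y ∈ seq d j → x < y
sep-< d {i} {suc j} i<1+j x∈ y∈ with m<1+n⇒m<n∨m≡n i<1+j
... | inj₂ refl = sep d i _ _ x∈ y∈
... | inj₁ i<j with _ , z∈ ← ∃-∈-seq d j = <-trans (sep-< d i<j x∈ z∈) (sep d j _ _ z∈ y∈)

index-mono : (d : ℙ) {i j x y : ℕ} → x ∈ seq d i → y ∈ seq d j → x ≤ y → i ≤ j
index-mono d x∈ y∈ x≤y = ≮⇒≥ (λ j<i → <⇒≱ (sep-< d j<i y∈ x∈) x≤y)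

module _ {π : ℕ → ℕ} {Z : Pred ℕ 0ℓ} {z : ℕ} where

  singleton-elim : ImageIsSingleton π Z z → ∀ {x} → Z x → π x ≡ z
  singleton-elim img x∈ = to (img _) (_ , x∈ , refl)

  singleton-intro : ∀ {x₀} → Z x₀ → (∀ {x} → Z x → π x ≡ z) → ImageIsSingleton π Z z
  singleton-intro {x₀} x₀∈ const y =
    mk⇔ (λ { (x , x∈ , refl) → const x∈ }) (λ { refl → x₀ , x₀∈ , const x₀∈ })

singleton? : (π : ℕ → ℕ) (xs : List ℕ) {x₀ : ℕ} → x₀ ∈ xs → (z : ℕ) →
             Dec (ImageIsSingleton π (_∈ xs) z)
singleton? π xs x₀∈ z =
  map′ (λ all → singleton-intro x₀∈ (All.lookup all))
       (λ img → All.tabulate (singleton-elim img))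
       (All.all? (λ x → π x ≟ z) xs)

module _ {π ψ : ℕ → ℕ} {b : ℙ} (N : NormalTriple π ψ b) where
  open NormalTriple N

  π-on-block : ∀ {l x} → x ∈ seq b l → π x ≡ ψ l
  π-on-block {l} x∈ = singleton-elim (π-img l) x∈

  π-mono-on-blocks : ∀ {i j x y} → x ∈ seq b i → y ∈ seq b j → x ≤ y → π x ≤ π y
  π-mono-on-blocks x∈ y∈ x≤y = subst₂ _≤_ (sym (π-on-block x∈)) (sym (π-on-block y∈))
    (ψ-mono _ _ (index-mono b x∈ y∈ x≤y))

module Refinement {π ψ : ℕ → ℕ} {b : ℙ} (N : NormalTriple π ψ b)
         {c : ℙ} {n₀ : ℕ} (c≤b : c ≤[ n₀ ] b) where
  open NormalTriple N

  π-const-on-tail : ∀ {m x y} → n₀ ≤ m → x ∈ seq c m → y ∈ seq c m → π x ≡ π y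
  π-const-on-tail {m} n₀≤m x∈ y∈ with c≤b m n₀≤m
  ... | _ , _ , c⊆b = trans (π-on-block N (c⊆b _ x∈)) (sym (π-on-block N (c⊆b _ y∈)))

  ψ≤π-on-tail : ∀ {m x} → n₀ ≤ m → x ∈ seq c m → ψ m ≤ π x
  ψ≤π-on-tail {m} n₀≤m x∈ with c≤b m n₀≤m
  ... | j , m≤j , c⊆b = ≤-trans (ψ-mono m j m≤j) (≤-reflexive (sym (π-on-block N (c⊆b _ x∈))))

  π-mono-on-tail : ∀ {m m′ x y} → n₀ ≤ m → m ≤ m′ → x ∈ seq c m → y ∈ seq c m′ → π x ≤ π y
  π-mono-on-tail {m} {m′} n₀≤m m≤m′ x∈ y∈ with m≤n⇒m<n∨m≡n m≤m′
  ... | inj₂ refl = ≤-reflexive (π-const-on-tail n₀≤m x∈ y∈)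
  ... | inj₁ m<m′ with c≤b m n₀≤m | c≤b m′ (≤-trans n₀≤m m≤m′)
  ...   | _ , _ , c⊆b | _ , _ , c⊆b′ =
    π-mono-on-blocks N (c⊆b _ x∈) (c⊆b′ _ y∈) (<⇒≤ (sep-< c m<m′ x∈ y∈))

  module _ (a : ℕ → ℕ) where

    F? : ∀ n → Decidable (F π c a n)
    F? n m = singleton? π (seq c m) (proj₂ (∃-∈-seq c m)) (a n)

    F-intro : ∀ {n m x} → n₀ ≤ m → x ∈ seq c m → π x ≡ a n → F π c a n m
    F-intro n₀≤m x∈ πx≡ = singleton-intro x∈ (λ y∈ → trans (π-const-on-tail n₀≤m y∈ x∈) πx≡)

    F-meets-tail : ∀ {n} → image π (setFrom c n₀) (a n) → ∃ (F π c a n ∖below n₀)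
    F-meets-tail (x , (m , n₀≤m , x∈) , πx≡) = m , F-intro n₀≤m x∈ πx≡ , n₀≤m

    F-bounded : ∀ n → ∃[ B ] (∀ {m} → F π c a n m → m < B)
    F-bounded n with ψ-ranInf (suc (a n))
    ... | _ , a<ψl , l , refl = n₀ + l , bound
      where
      bound : ∀ {m} → F π c a n m → m < n₀ + l
      bound {m} Fm with m <? n₀
      ... | yes m<n₀ = <-≤-trans m<n₀ (m≤m+n n₀ l)
      ... | no  m≮n₀ = <-≤-trans (≰⇒> l≰m) (m≤n+m l n₀)
        where
        open ≤-Reasoning
        l≰m : ¬ l ≤ m
        l≰m l≤m with x , x∈ ← ∃-∈-seq c m = <⇒≱ a<ψl (begin
          ψ l   ≤⟨ ψ-mono l m l≤m ⟩
          ψ m   ≤⟨ ψ≤π-on-tail (≮⇒≥ m≮n₀) x∈ ⟩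
          π x   ≡⟨ singleton-elim Fm x∈ ⟩
          a n   ∎)

    F-mono : ∀ {n n′ m m′} → n₀ ≤ m → m ≤ m′ → F π c a n m → F π c a n′ m′ → a n ≤ a n′
    F-mono {m = m} {m′} n₀≤m m≤m′ Fm Fm′
      with _ , x∈ ← ∃-∈-seq c m | _ , y∈ ← ∃-∈-seq c m′ =
      subst₂ _≤_ (singleton-elim Fm x∈) (singleton-elim Fm′ y∈) (π-mono-on-tail n₀≤m m≤m′ x∈ y∈)

    F-max<min-tail : ∀ {n n′ mx mn} → a n < a n′ →
                     IsMax (F π c a n) mx → IsMin (F π c a n′ ∖below n₀) mn → mx < mn
    F-max<min-tail an<an′ (Fmx , _) ((Fmn , n₀≤mn) , _) =
      ≰⇒> λ mn≤mx → <⇒≱ an<an′ (F-mono n₀≤mn mn≤mx Fmn Fmx)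

lemma2p9 : (π ψ : ℕ → ℕ) (b : ℙ) → NormalTriple π ψ b →
    (c : ℙ) (n₀ : ℕ) → c ≤[ n₀ ] b →
    (A : Pred ℕ 0ℓ) (a : ℕ → ℕ) → Enumerates A a → Infinite A →
    A ⊆ image π (setFrom c n₀) →
    ∀ n →
      (∃[ m ] ((F π c a n ∖below n₀) m))
      × Finite (F π c a n)
      × (∃[ mx ] ∃[ mn ] ∃[ mx′ ]
          (IsMax (F π c a n) mx × IsMin (F π c a (suc n) ∖below n₀) mn
           × IsMax (F π c a (suc n)) mx′ × mx < mn × mn ≤ mx′))
lemma2p9 π ψ b N c n₀ c≤b A a (a-inc , a-enum) _ A⊆img n =
  let mx , maxₙ = ∃max n
      mx′ , maxₙ₊₁ = ∃max (suc n)
      mn , minₙ₊₁ = ∃min (F? a (suc n) ∩? (n₀ ≤?_)) (proj₂ (meets-tail (suc n)))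
  in meets-tail n , bounded⇒finite (F? a n) (proj₂ (F-bounded a n)) ,
     mx , mn , mx′ , maxₙ , minₙ₊₁ , maxₙ₊₁ ,
     F-max<min-tail a (a-inc n) maxₙ minₙ₊₁ , proj₂ maxₙ₊₁ mn (proj₁ (proj₁ minₙ₊₁))
  where
  open Refinement N {c} {n₀} c≤b

  meets-tail : ∀ n → ∃ (F π c a n ∖below n₀)
  meets-tail n = F-meets-tail a (A⊆img (from (a-enum (a n)) (n , refl)))

  ∃max : ∀ n → ∃ (IsMax (F π c a n))
  ∃max n = bounded⇒∃max (F? a n) (proj₂ (F-bounded a n)) (proj₁ (proj₂ (meets-tail n)))
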